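{- Let $p\ge3$ be prime and let $F=a_1P_{m_1}+a_2P_{m_2}+a_3P_{m_3}$ be a node of the escalator tree $T_\infty$ with $p\nmid a_1a_2(m_1-2)(m_2-2)$. If either (1) $p^2\mid a_3$, or (2) $p\mid a_3$, $p\nmid(m_3-2)$ and $t(F)\ge p^2$, then $$\left(\frac{ -a_1a_2(m_1-2)(m_2-2)}{p}\right)=1.$$
   Context: For $m\ge3$, $P_m(x)=\frac{(m-2)x^2-(m-4)x}{2}$ ($x\in\mathbb{Z}$). A sum $F=\sum_ja_jP_{m_j}$ has integers $1\le a_1\le\dots\le a_r$, $m_j\ge3$; it represents $n$ if $n=F(x)$ for some $x\in\mathbb{Z}^r$, and is universal if it represents every positive integer; the truant $t(F)$ is the least positive integer not represented ($\infty$ if universal). The escalator tree $T_\infty$ has root the empty sum $F=0$ (depth 0, truant 1); universal nodes are leaves; the children of a node $F=\sum_{j=1}^ra_jP_{m_j}$ with $t(F)<\infty$ are all $F+a_{r+1}P_{m_{r+1}}$ with $a_r\le a_{r+1}\le t(F)$, $m_{r+1}\ge3$, $m_{r+1}\ne6$, and $m_r\le m_{r+1}$ if $a_r=a_{r+1}$ (children of the root: $P_{m_1}$, $m_1\ne6$). $\left(\frac{\cdot}{p}\right)$ is the Legendre symbol. -}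

module Defs where

open import Data.Nat as ℕ using (ℕ; zero; suc; _≤_; _<_; NonZero)
open import Data.Integer as ℤ using (ℤ; +_; -[1+_])
open import Data.Integer.DivMod using (_/_; _%ℕ_)
open import Data.List using (List; []; _∷_; length; upTo)
open import Data.Bool.ListAction using (any)
open import Data.Vec using (Vec; []; _∷_)
open import Data.Product using (_×_; _,_; ∃; ∃-syntax)
open import Data.Sum using (_⊎_)
open import Data.Bool using (Bool; true; false; if_then_else_)
open import Relation.Binary.PropositionalEquality using (_≡_; _≢_)
open import Relation.Nullary using (¬_)
open import Relation.Nullary.Decidable using (⌊_⌋)

-- The polygonal-number polynomial P_m(x) = ((m-2)x^2 - (m-4)x)/2  (exact division).
P : ℕ → ℤ → ℤ
P m x = ((+ m ℤ.- + 2) ℤ.* x ℤ.* x ℤ.- (+ m ℤ.- + 4) ℤ.* x) / (+ 2)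

-- A form F = Σ a_j P_{m_j} is a list of pairs (a_j , m_j).
-- CONVENTION: lists are stored NEWEST-FIRST, i.e. (a_r , m_r) ∷ ... ∷ (a_1 , m_1) ∷ [].
Form : Set
Form = List (ℕ × ℕ)

eval : (F : Form) → Vec ℤ (length F) → ℤ
eval [] [] = + 0
eval ((a , m) ∷ F) (x ∷ xs) = + a ℤ.* P m x ℤ.+ eval F xs

Represents : Form → ℕ → Set
Represents F n = ∃[ xs ] (eval F xs ≡ + n)

Universal : Form → Set
Universal F = (n : ℕ) → 1 ≤ n → Represents F n

Truant : Form → ℕ → Set
Truant F t = 1 ≤ t × ¬ Represents F t × ((n : ℕ) → 1 ≤ n → n < t → Represents F n)

-- t(F) ≥ k  (with t(F) = ∞ when F is universal)
TruantAtLeast : Form → ℕ → Set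
TruantAtLeast F k = Universal F ⊎ ∃[ t ] (Truant F t × k ≤ t)

NewOK : Form → ℕ → ℕ → Set
NewOK [] a m = 1 ≤ a
NewOK ((aᵣ , mᵣ) ∷ _) a m = aᵣ ≤ a × (aᵣ ≡ a → mᵣ ≤ m)

-- Nodes of the escalator tree T_∞.  The root [] has truant 1, so its children
-- have a = 1 automatically.
data Node : Form → Set where
  root  : Node []
  child : ∀ {F a m} → Node F → (t : ℕ) → Truant F t →
          NewOK F a m → a ≤ t → 3 ≤ m → m ≢ 6 → Node ((a , m) ∷ F)

legendre : ℤ → (p : ℕ) → .{{NonZero p}} → ℤ
legendre a p with a %ℕ p
... | zero = + 0
... | suc r = if any (λ x → ⌊ (x ℕ.* x) ℕ.% p ℕ.≟ suc r ⌋) (upTo p) then + 1 else -[1+ 0 ]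

-- Suppose −Δ, where Δ = a₁a₂(m₁−2)(m₂−2), is a non-residue modulo p. Completing the square,
-- 8(m−2)·P_m(x) = X² − (m−4)² with X = 2(m−2)x − (m−4), so that with M = 8(m₁−2)(m₂−2)
--   M·(a₁P_{m₁}(x) + a₂P_{m₂}(y)) = A·X₁² + B·X₂² − C,   A = a₁(m₂−2), B = a₂(m₁−2), AB = Δ.
-- As −AB is a non-residue, the binary form A·X² + B·Y² is anisotropic modulo p: if p divides
-- A·X² + B·Y² then p divides X and Y, hence p² divides A·X² + B·Y².
-- Either hypothesis gives a₃ = a′p, makes F represent every n < p², and yields a constant k
-- missed by M·a′·P_{m₃} modulo p (k = 1 if p ∣ a′; otherwise p ∤ m₃−2 and completing the square
-- in z reduces this to −Δ being a non-residue). Take n < p² with M·n ≡ kp − C (mod p²) and write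
-- n = F(x, y, z): then A·X₁² + B·X₂² ≡ p·(k − M·a′·P_{m₃}(z)) (mod p²) is divisible by p but
-- not by p², a contradiction.

module Submission where

open import Data.Bool using (true; false; T)
open import Data.Bool.ListAction using (any)
open import Data.Empty using (⊥; ⊥-elim)
open import Data.Integer as ℤ using (ℤ; +_; -[1+_]; -_; _+_; _-_; _*_)
open import Data.Integer.DivMod using (_%ℕ_; _/ℕ_; a≡a%ℕn+[a/ℕn]*n; a≡a%n+[a/n]*n; n%ℕd<d)
open import Data.Integer.Divisibility using (_∣_)
open import Data.Integer.Divisibility.Signed renaming (_∣_ to _∣ₛ_; _∣?_ to _∣ₛ?_)
import Data.Integer.Properties as ℤ
open import Data.Integer.Tactic.RingSolver using (solve-∀)
open import Data.List using ([]; _∷_; upTo)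
open import Data.List.Membership.Propositional using (lose)
open import Data.List.Membership.Propositional.Properties using (∈-upTo⁺)
open import Data.List.Relation.Unary.Any.Properties using (any⁺)
open import Data.Nat as ℕ using (ℕ; zero; suc; NonZero; nonTrivial⇒≢1; _^_; _≤_)
open import Data.Nat.Coprimality using (Coprime; coprime-Bézout)
import Data.Nat.Divisibility as ℕ
open import Data.Nat.GCD using (module Bézout)
open import Data.Nat.Primality using (Prime; euclidsLemma; prime⇒irreducible; prime⇒nonTrivial; prime⇒nonZero)
import Data.Nat.Properties as ℕ
open import Data.Product using (∃-syntax; _×_; _,_; proj₁; proj₂)
open import Data.Sum as Sum using (_⊎_; inj₁; inj₂)
open import Data.Vec using ([]; _∷_)
open import Function using (_∘_; flip; id)
open import Relation.Binary.PropositionalEquality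
open import Relation.Nullary using (¬_; Dec; contradiction; yes; no)
open import Relation.Nullary.Decidable using (⌊_⌋; fromWitness)

open import Defs

module _ {d : ℕ} .{{_ : NonZero d}} where

  small-multiple≡0 : ∀ i → ℤ.∣ i ∣ ℕ.< d → + d ∣ₛ i → i ≡ + 0
  small-multiple≡0 i ∣i∣<d d∣i with ℤ.∣ i ∣ in ∣i∣≡ | ∣⇒∣ᵤ d∣i
  ... | zero  | _   = ℤ.∣i∣≡0⇒i≡0 ∣i∣≡
  ... | suc _ | d∣′ = contradiction d∣′ (ℕ.>⇒∤ ∣i∣<d)

  ∣i-j⇒i%ℕd≡j%ℕd : ∀ i j → + d ∣ₛ i - j → i %ℕ d ≡ j %ℕ d
  ∣i-j⇒i%ℕd≡j%ℕd i j d∣i-j =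
    ℤ.+-injective (ℤ.i-j≡0⇒i≡j _ _ (small-multiple≡0 _ ∣r-s∣<d d∣r-s))
    where
    r = i %ℕ d
    s = j %ℕ d
    remainders : ∀ r s q t D → r - s ≡ ((r + q * D) - (s + t * D)) - (q - t) * D
    remainders = solve-∀
    d∣r-s : + d ∣ₛ + r - + s
    d∣r-s = subst (+ d ∣ₛ_)
      (trans (cong₂ (λ i′ j′ → (i′ - j′) - (i /ℕ d - j /ℕ d) * + d)
                    (a≡a%ℕn+[a/ℕn]*n i d) (a≡a%ℕn+[a/ℕn]*n j d))
             (sym (remainders (+ r) (+ s) (i /ℕ d) (j /ℕ d) (+ d))))
      (∣m∣n⇒∣m-n d∣i-j (divides (i /ℕ d - j /ℕ d) refl))
    ∣r-s∣<d : ℤ.∣ + r - + s ∣ ℕ.< d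
    ∣r-s∣<d = subst (ℕ._< d) (cong ℤ.∣_∣ (sym (ℤ.m-n≡m⊖n r s)))
      (ℕ.≤-<-trans (ℤ.∣m⊝n∣≤m⊔n r s) (ℕ.⊔-lub (n%ℕd<d i d) (n%ℕd<d j d)))

  %ℕ≡0⇒∣ : ∀ i → i %ℕ d ≡ 0 → + d ∣ₛ i
  %ℕ≡0⇒∣ i i%d≡0 = divides (i /ℕ d)
    (trans (a≡a%ℕn+[a/ℕn]*n i d)
           (trans (cong (λ r → + r + i /ℕ d * + d) i%d≡0) (ℤ.+-identityˡ _)))

  ∣⇒%ℕ≡0 : ∀ i → + d ∣ₛ i → i %ℕ d ≡ 0
  ∣⇒%ℕ≡0 i d∣i = trans (∣i-j⇒i%ℕd≡j%ℕd i (+ 0) (subst (+ d ∣ₛ_) (sym (ℤ.+-identityʳ i)) d∣i))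
                       (ℕ.n∣m⇒m%n≡0 0 d (d ℕ.∣0))

  ∣⇒[i/d]*d≡i : ∀ i → + d ∣ₛ i → (i ℤ./ + d) * + d ≡ i
  ∣⇒[i/d]*d≡i i d∣i = sym (begin
    i                                   ≡⟨ a≡a%n+[a/n]*n i (+ d) ⟩
    + (i %ℕ d) + (i ℤ./ + d) * + d      ≡⟨ cong (λ r → + r + (i ℤ./ + d) * + d) (∣⇒%ℕ≡0 i d∣i) ⟩
    + 0 + (i ℤ./ + d) * + d             ≡⟨ ℤ.+-identityˡ _ ⟩
    (i ℤ./ + d) * + d                   ∎)
    where open ≡-Reasoning

  linear-congruence : ∀ w y → + d ∣ₛ w * y - + 1 → ∀ t → ∃[ n ] n ℕ.< d × + d ∣ₛ y * + n - t
  linear-congruence w y d∣wy-1 t = n , n%ℕd<d (w * t) d ,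
    subst (+ d ∣ₛ_) rearranged (∣m∣n⇒∣m-n (∣m⇒∣m*n t d∣wy-1) (divides (y * q) refl))
    where
    n = (w * t) %ℕ d
    q = (w * t) /ℕ d
    expand : ∀ w y t → (w * y - + 1) * t ≡ y * (w * t) - t
    expand = solve-∀
    cancel : ∀ y n q D t → y * (n + q * D) - t - y * q * D ≡ y * n - t
    cancel = solve-∀
    rearranged : (w * y - + 1) * t - y * q * + d ≡ y * + n - t
    rearranged = begin
      (w * y - + 1) * t - y * q * + d       ≡⟨ cong (_- y * q * + d) (expand w y t) ⟩
      y * (w * t) - t - y * q * + d         ≡⟨ cong (λ u → y * u - t - y * q * + d) (a≡a%ℕn+[a/ℕn]*n (w * t) d) ⟩
      y * (+ n + q * + d) - t - y * q * + d ≡⟨ cancel y (+ n) q (+ d) t ⟩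
      y * + n - t                           ∎
      where open ≡-Reasoning

inverse-lift : ∀ {d} w y → d ∣ₛ w * y - + 1 → d * d ∣ₛ w * (+ 2 - w * y) * y - + 1
inverse-lift {d} w y (divides t wy-1≡td) = divides (- (t * t)) (begin
  w * (+ 2 - w * y) * y - + 1        ≡⟨ negSquare w y ⟩
  - ((w * y - + 1) * (w * y - + 1))  ≡⟨ cong (λ u → - (u * u)) wy-1≡td ⟩
  - (t * d * (t * d))                ≡⟨ regroup t d ⟩
  - (t * t) * (d * d)                ∎)
  where
  open ≡-Reasoning
  negSquare : ∀ w y → w * (+ 2 - w * y) * y - + 1 ≡ - ((w * y - + 1) * (w * y - + 1))
  negSquare = solve-∀
  regroup : ∀ t d → - (t * d * (t * d)) ≡ - (t * t) * (d * d)
  regroup = solve-∀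

square-∣ : ∀ {d} A B X Y → d ∣ₛ X → d ∣ₛ Y → d * d ∣ₛ A * X * X + B * Y * Y
square-∣ {d} A B _ _ (divides u refl) (divides v refl) =
  divides (A * u * u + B * v * v) (regroup A B u v d)
  where
  regroup : ∀ A B u v d → A * (u * d) * (u * d) + B * (v * d) * (v * d) ≡ (A * u * u + B * v * v) * (d * d)
  regroup = solve-∀

pos-^2 : ∀ n → + (n ^ 2) ≡ + n * + n
pos-^2 n = trans (cong (λ m → + (n ℕ.* m)) (ℕ.*-identityʳ n)) (ℤ.pos-* n n)

module _ {p : ℕ} (prime : Prime p) where

  p∣xy⇒p∣x⊎p∣y : ∀ x y → + p ∣ₛ x * y → + p ∣ₛ x ⊎ + p ∣ₛ y
  p∣xy⇒p∣x⊎p∣y x y p∣xy =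
    Sum.map ∣ᵤ⇒∣ ∣ᵤ⇒∣ (euclidsLemma ℤ.∣ x ∣ ℤ.∣ y ∣ prime (subst (p ℕ.∣_) (ℤ.abs-* x y) (∣⇒∣ᵤ p∣xy)))

  ∤-* : ∀ {x y} → ¬ + p ∣ₛ x → ¬ + p ∣ₛ y → ¬ + p ∣ₛ x * y
  ∤-* {x} {y} p∤x p∤y p∣xy = Sum.[ p∤x , p∤y ]′ (p∣xy⇒p∣x⊎p∣y x y p∣xy)

  ∤1 : ¬ + p ∣ₛ + 1
  ∤1 p∣1 = nonTrivial⇒≢1 {{prime⇒nonTrivial prime}} (ℕ.∣1⇒≡1 (∣⇒∣ᵤ p∣1))

  ∤⇒coprime : ∀ {n} → ¬ p ℕ.∣ n → Coprime p n
  ∤⇒coprime p∤n (d∣p , d∣n) with prime⇒irreducible prime d∣p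
  ... | inj₁ d≡1  = d≡1
  ... | inj₂ refl = contradiction d∣n p∤n

  inverse-mod : ∀ y → ¬ + p ∣ₛ y → ∃[ w ] + p ∣ₛ w * y - + 1
  inverse-mod (+ n) p∤n = inverseℕ (coprime-Bézout (∤⇒coprime (p∤n ∘ ∣ᵤ⇒∣)))
    where
    cast : ∀ a b c e → 1 ℕ.+ a ℕ.* b ≡ c ℕ.* e → + 1 + + a * + b ≡ + c * + e
    cast a b c e eq =
      trans (cong (_+_ (+ 1)) (sym (ℤ.pos-* a b))) (trans (cong +_ eq) (ℤ.pos-* c e))
    inverseℕ : Bézout.Identity 1 p n → ∃[ w ] + p ∣ₛ w * + n - + 1
    inverseℕ (Bézout.+- x y eq) = - + y , divides (- + x) (begin
      - + y * + n - + 1     ≡⟨ negate (+ y) (+ n) ⟩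
      - (+ 1 + + y * + n)   ≡⟨ cong -_ (cast y n x p eq) ⟩
      - (+ x * + p)         ≡⟨ ℤ.neg-distribˡ-* (+ x) (+ p) ⟩
      - + x * + p           ∎)
      where
      open ≡-Reasoning
      negate : ∀ y n → - y * n - + 1 ≡ - (+ 1 + y * n)
      negate = solve-∀
    inverseℕ (Bézout.-+ x y eq) = + y , divides (+ x) (begin
      + y * + n - + 1             ≡⟨ cong (_- + 1) (sym (cast x p y n eq)) ⟩
      + 1 + + x * + p - + 1       ≡⟨ cancel (+ x * + p) ⟩
      + x * + p                   ∎)
      where
      open ≡-Reasoning
      cancel : ∀ u → + 1 + u - + 1 ≡ u
      cancel = solve-∀
  inverse-mod -[1+ n ] p∤y with inverse-mod (+ ℕ.suc n) (p∤y ∘ ∣m⇒∣-m)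
  ... | w , p∣wn-1 = - w , subst (+ p ∣ₛ_) (negNeg w (+ ℕ.suc n)) p∣wn-1
    where
    negNeg : ∀ w n → w * n - + 1 ≡ - w * - n - + 1
    negNeg = solve-∀

  anisotropic : ∀ {A B} → ¬ + p ∣ₛ A → (∀ W → ¬ + p ∣ₛ W * W + A * B) →
                ∀ X Y → + p ∣ₛ A * X * X + B * Y * Y → + p ∣ₛ X × + p ∣ₛ Y
  anisotropic {A} {B} p∤A nonResidue X Y p∣Q with + p ∣ₛ? Y
  ... | yes p∣Y = p∣X , p∣Y
    where
    p∣X : + p ∣ₛ X
    p∣X with p∣xy⇒p∣x⊎p∣y (A * X) X (∣m+n∣n⇒∣m p∣Q (∣n⇒∣m*n (B * Y) p∣Y))
    ... | inj₂ p∣X = p∣X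
    ... | inj₁ p∣AX = Sum.[ flip contradiction p∤A , id ]′ (p∣xy⇒p∣x⊎p∣y A X p∣AX)
  ... | no p∤Y with inverse-mod Y p∤Y
  ... | w , p∣wY-1 = contradiction
          (subst (+ p ∣ₛ_) (sym (identity w A B X Y))
                 (∣m∣n⇒∣m-n (∣n⇒∣m*n (w * w * A) p∣Q) (∣n⇒∣m*n (A * B * (w * Y + + 1)) p∣wY-1)))
          (nonResidue (w * A * X))
    where
    identity : ∀ w A B X Y → w * A * X * (w * A * X) + A * B
             ≡ w * w * A * (A * X * X + B * Y * Y) - A * B * (w * Y + + 1) * (w * Y - + 1)
    identity = solve-∀

legendre-cases : ∀ a p .{{_ : NonZero p}} →
                 legendre a p ≡ + 1 ⊎ + p ∣ₛ a ⊎ (∀ W → ¬ + p ∣ₛ W * W - a)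
legendre-cases a p with a %ℕ p in a%p
... | zero = inj₂ (inj₁ (%ℕ≡0⇒∣ a a%p))
... | suc r with any (λ x → ⌊ (x ℕ.* x) ℕ.% p ℕ.≟ suc r ⌋) (upTo p) in noRoot
...   | true  = inj₁ refl
...   | false = inj₂ (inj₂ λ W p∣W²-a →
  subst T noRoot (any⁺ _ (lose (∈-upTo⁺ (n%ℕd<d W p)) (fromWitness (root-residue W p∣W²-a)))))
  where
  root-residue : ∀ W → + p ∣ₛ W * W - a → ((W %ℕ p) ℕ.* (W %ℕ p)) ℕ.% p ≡ suc r
  root-residue W p∣W²-a = trans (∣i-j⇒i%ℕd≡j%ℕd (+ (x ℕ.* x)) a p∣x²-a) a%p
    where
    x = W %ℕ p
    q = W /ℕ p
    shift : ∀ x q P a → x * x - a ≡ ((x + q * P) * (x + q * P) - a) - q * P * ((x + q * P) + x)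
    shift = solve-∀
    p∣x²-a : + p ∣ₛ + (x ℕ.* x) - a
    p∣x²-a = subst (+ p ∣ₛ_)
      (sym (trans (cong (_- a) (ℤ.pos-* x x))
                  (trans (shift (+ x) q (+ p) a)
                         (cong (λ V → (V * V - a) - q * + p * (V + + x)) (sym (a≡a%ℕn+[a/ℕn]*n W p))))))
      (∣m∣n⇒∣m-n p∣W²-a (∣m⇒∣m*n (W + + x) (divides q refl)))

even-product : ∀ x → + 2 ∣ₛ x * (x - + 1)
even-product x with x %ℕ 2 | a≡a%ℕn+[a/ℕn]*n x 2 | n%ℕd<d x 2
... | 0 | x≡2q | _ = divides (x /ℕ 2 * (x - + 1))
        (trans (cong (λ y → y * (x - + 1)) x≡2q) (even (x /ℕ 2) (x - + 1)))
  where
  even : ∀ q y → (+ 0 + q * + 2) * y ≡ q * y * + 2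
  even = solve-∀
... | 1 | x≡2q+1 | _ = divides (x * (x /ℕ 2))
        (trans (cong (λ y → x * (y - + 1)) x≡2q+1) (odd x (x /ℕ 2)))
  where
  odd : ∀ x q → x * ((+ 1 + q * + 2) - + 1) ≡ x * q * + 2
  odd = solve-∀
... | suc (suc _) | _ | ℕ.s≤s (ℕ.s≤s ())

P-numerator-even : ∀ m x → + 2 ∣ₛ (+ m - + 2) * x * x - (+ m - + 4) * x
P-numerator-even m x = subst (+ 2 ∣ₛ_) (sym (split (+ m) x))
  (∣m∣n⇒∣m+n (∣n⇒∣m*n (+ m - + 2) (even-product x)) (divides x refl))
  where
  split : ∀ m x → (m - + 2) * x * x - (m - + 4) * x ≡ (m - + 2) * (x * (x - + 1)) + x * + 2
  split = solve-∀

P*2 : ∀ m x → P m x * + 2 ≡ (+ m - + 2) * x * x - (+ m - + 4) * x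
P*2 m x = ∣⇒[i/d]*d≡i _ (P-numerator-even m x)

P-zero : ∀ m → P m (+ 0) ≡ + 0
P-zero m = ℤ.*-cancelʳ-≡ (P m (+ 0)) (+ 0) (+ 2) (trans (P*2 m (+ 0)) (vanish (+ m)))
  where
  vanish : ∀ m → (m - + 2) * + 0 * + 0 - (m - + 4) * + 0 ≡ + 0 * + 2
  vanish = solve-∀

P-complete-square : ∀ m x → + 8 * (+ m - + 2) * P m x
  ≡ (+ 2 * (+ m - + 2) * x - (+ m - + 4)) * (+ 2 * (+ m - + 2) * x - (+ m - + 4)) - (+ m - + 4) * (+ m - + 4)
P-complete-square m x = trans (regroup (+ m) (P m x)) (trans (cong (+ 4 * (+ m - + 2) *_) (P*2 m x)) (square (+ m) x))
  where
  regroup : ∀ m P → + 8 * (m - + 2) * P ≡ + 4 * (m - + 2) * (P * + 2)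
  regroup = solve-∀
  square : ∀ m x → + 4 * (m - + 2) * ((m - + 2) * x * x - (m - + 4) * x)
         ≡ (+ 2 * (m - + 2) * x - (m - + 4)) * (+ 2 * (m - + 2) * x - (m - + 4)) - (m - + 4) * (m - + 4)
  square = solve-∀

RepresentsBelow : Form → ℕ → Set
RepresentsBelow F k = ∀ n → n ℕ.< k → Represents F n

extend-represents : ∀ {F n} a m → Represents F n → Represents ((a , m) ∷ F) n
extend-represents {F} a m (xs , Fxs≡n) = + 0 ∷ xs , (begin
  + a * P m (+ 0) + eval F xs   ≡⟨ cong (λ v → + a * v + eval F xs) (P-zero m) ⟩
  + a * + 0 + eval F xs         ≡⟨ cong (_+ eval F xs) (ℤ.*-zeroʳ (+ a)) ⟩
  + 0 + eval F xs               ≡⟨ ℤ.+-identityˡ (eval F xs) ⟩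
  eval F xs                     ≡⟨ Fxs≡n ⟩
  + _                           ∎)
  where open ≡-Reasoning

represents-zero : ∀ F → Represents F 0
represents-zero []            = [] , refl
represents-zero ((a , m) ∷ F) = extend-represents a m (represents-zero F)

representsBelow : ∀ F {k} → (∀ n → 1 ℕ.≤ n → n ℕ.< k → Represents F n) → RepresentsBelow F k
representsBelow F _    zero    _   = represents-zero F
representsBelow F reps (suc n) n<k = reps (suc n) (ℕ.s≤s ℕ.z≤n) n<k

representsBelow-mono : ∀ {F k l} → k ℕ.≤ l → RepresentsBelow F l → RepresentsBelow F k
representsBelow-mono k≤l reps n n<k = reps n (ℕ.<-≤-trans n<k k≤l)

truantAtLeast⇒representsBelow : ∀ {F k} → TruantAtLeast F k → RepresentsBelow F k
truantAtLeast⇒representsBelow {F} (inj₁ universal) =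
  representsBelow F (λ n 1≤n _ → universal n 1≤n)
truantAtLeast⇒representsBelow {F} (inj₂ (t , (_ , _ , represented) , k≤t)) =
  representsBelow F (λ n 1≤n n<k → represented n 1≤n (ℕ.<-≤-trans n<k k≤t))

node-representsBelow-last : ∀ {F a m} → Node ((a , m) ∷ F) → RepresentsBelow ((a , m) ∷ F) a
node-representsBelow-last {F} {a} {m} (child _ t (_ , _ , represented) _ a≤t _ _) =
  representsBelow ((a , m) ∷ F) (λ n 1≤n n<a → extend-represents a m (represented n 1≤n (ℕ.<-≤-trans n<a a≤t)))

node-last-coefficient-positive : ∀ {F a m} → Node ((a , m) ∷ F) → 1 ℕ.≤ a
node-last-coefficient-positive (child root _ _ 1≤a _ _ _) = 1≤a
node-last-coefficient-positive (child node@(child _ _ _ _ _ _ _) _ _ (aᵣ≤a , _) _ _ _) =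
  ℕ.≤-trans (node-last-coefficient-positive node) aᵣ≤a

p∣a₃∧representsBelow-p² : ∀ p {F a₃ m₃} → Node ((a₃ , m₃) ∷ F) →
  + (p ^ 2) ∣ + a₃ ⊎ (+ p ∣ + a₃ × ¬ + p ∣ + m₃ - + 2 × TruantAtLeast ((a₃ , m₃) ∷ F) (p ^ 2)) →
  ∃[ a′ ] + a₃ ≡ a′ * + p × (+ p ∣ₛ a′ ⊎ ¬ + p ∣ₛ + m₃ - + 2) × RepresentsBelow ((a₃ , m₃) ∷ F) (p ^ 2)
p∣a₃∧representsBelow-p² p {a₃ = a₃} node (inj₁ (ℕ.divides q a₃≡qp²)) =
  + q * + p , a₃≡a′p , inj₁ (divides (+ q) refl) ,
  representsBelow-mono (ℕ.∣⇒≤ {{a₃≢0}} (ℕ.divides q a₃≡qp²)) (node-representsBelow-last node)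
  where
  a₃≢0 : NonZero a₃
  a₃≢0 = ℕ.>-nonZero (node-last-coefficient-positive node)
  a₃≡a′p : + a₃ ≡ + q * + p * + p
  a₃≡a′p = begin
    + a₃                 ≡⟨ cong +_ a₃≡qp² ⟩
    + (q ℕ.* p ^ 2)      ≡⟨ ℤ.pos-* q (p ^ 2) ⟩
    + q * + (p ^ 2)      ≡⟨ cong (+ q *_) (pos-^2 p) ⟩
    + q * (+ p * + p)    ≡⟨ ℤ.*-assoc (+ q) (+ p) (+ p) ⟨
    + q * + p * + p      ∎
    where open ≡-Reasoning
p∣a₃∧representsBelow-p² p node (inj₂ (p∣a₃ , p∤D₃ , truant)) with ∣ᵤ⇒∣ p∣a₃
... | divides a′ a₃≡a′p =
  a′ , a₃≡a′p , inj₂ (p∤D₃ ∘ ∣⇒∣ᵤ) , truantAtLeast⇒representsBelow truant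

module Obstruction {p : ℕ} (prime : Prime p) (a₁ m₁ a₂ m₂ : ℕ) where

  private instance
    p≢0 : NonZero p
    p≢0 = prime⇒nonZero prime
    p²≢0 : NonZero (p ^ 2)
    p²≢0 = ℕ.m^n≢0 p 2

  D₁ D₂ e₁ e₂ A B M C Δ : ℤ
  D₁ = + m₁ - + 2
  D₂ = + m₂ - + 2
  e₁ = + m₁ - + 4
  e₂ = + m₂ - + 4
  A = + a₁ * D₂
  B = + a₂ * D₁
  M = + 8 * D₁ * D₂
  C = A * e₁ * e₁ + B * e₂ * e₂
  Δ = + a₁ * + a₂ * D₁ * D₂

  X₁ X₂ : ℤ → ℤ
  X₁ x = + 2 * D₁ * x - e₁
  X₂ y = + 2 * D₂ * y - e₂

  binary-complete-square : ∀ x y →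
    A * X₁ x * X₁ x + B * X₂ y * X₂ y ≡ M * (+ a₁ * P m₁ x + + a₂ * P m₂ y) + C
  binary-complete-square x y = begin
    A * X₁ x * X₁ x + B * X₂ y * X₂ y
      ≡⟨ shift A B (X₁ x) (X₂ y) e₁ e₂ ⟩
    A * (X₁ x * X₁ x - e₁ * e₁) + B * (X₂ y * X₂ y - e₂ * e₂) + C
      ≡⟨ cong₂ (λ u v → A * u + B * v + C) (sym (P-complete-square m₁ x)) (sym (P-complete-square m₂ y)) ⟩
    A * (+ 8 * D₁ * P m₁ x) + B * (+ 8 * D₂ * P m₂ y) + C
      ≡⟨ collect (+ a₁) (+ a₂) D₁ D₂ (P m₁ x) (P m₂ y) C ⟩
    M * (+ a₁ * P m₁ x + + a₂ * P m₂ y) + C ∎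
    where
    open ≡-Reasoning
    shift : ∀ A B X₁ X₂ e₁ e₂ → A * X₁ * X₁ + B * X₂ * X₂
          ≡ A * (X₁ * X₁ - e₁ * e₁) + B * (X₂ * X₂ - e₂ * e₂) + (A * e₁ * e₁ + B * e₂ * e₂)
    shift = solve-∀
    collect : ∀ a₁ a₂ D₁ D₂ u v C → a₁ * D₂ * (+ 8 * D₁ * u) + a₂ * D₁ * (+ 8 * D₂ * v) + C
            ≡ + 8 * D₁ * D₂ * (a₁ * u + a₂ * v) + C
    collect = solve-∀

  quadratic-value : ∀ a₃ m₃ a′ k x y z {n} → + a₃ ≡ a′ * + p →
    eval ((a₃ , m₃) ∷ (a₂ , m₂) ∷ (a₁ , m₁) ∷ []) (z ∷ y ∷ x ∷ []) ≡ + n →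
    A * X₁ x * X₁ x + B * X₂ y * X₂ y ≡ (M * + n - (k * + p - C)) + + p * (k - M * a′ * P m₃ z)
  quadratic-value a₃ m₃ a′ k x y z {n} a₃≡a′p F[zyx]≡n = begin
    A * X₁ x * X₁ x + B * X₂ y * X₂ y
      ≡⟨ binary-complete-square x y ⟩
    M * (+ a₁ * P m₁ x + + a₂ * P m₂ y) + C
      ≡⟨ regroup M (+ a₁ * P m₁ x) (+ a₂ * P m₂ y) C a′ (+ p) (P m₃ z) k ⟩
    (M * (a′ * + p * P m₃ z + (+ a₂ * P m₂ y + (+ a₁ * P m₁ x + + 0))) - (k * + p - C)) + + p * (k - M * a′ * P m₃ z)
      ≡⟨ cong (λ v → (M * v - (k * + p - C)) + + p * (k - M * a′ * P m₃ z)) F[zyx]≡n′ ⟩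
    (M * + n - (k * + p - C)) + + p * (k - M * a′ * P m₃ z) ∎
    where
    open ≡-Reasoning
    regroup : ∀ M u v C a′ p P₃ k → M * (u + v) + C
            ≡ (M * (a′ * p * P₃ + (v + (u + + 0))) - (k * p - C)) + p * (k - M * a′ * P₃)
    regroup = solve-∀
    F[zyx]≡n′ : a′ * + p * P m₃ z + (+ a₂ * P m₂ y + (+ a₁ * P m₁ x + + 0)) ≡ + n
    F[zyx]≡n′ = trans (cong (λ c → c * P m₃ z + (+ a₂ * P m₂ y + (+ a₁ * P m₁ x + + 0))) (sym a₃≡a′p)) F[zyx]≡n

  ¬representsBelow-p² :
    (∀ X Y → + p ∣ₛ A * X * X + B * Y * Y → + p * + p ∣ₛ A * X * X + B * Y * Y) → ¬ + p ∣ₛ M →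
    ∀ a₃ m₃ a′ k → + a₃ ≡ a′ * + p → (∀ z → ¬ + p ∣ₛ k - M * a′ * P m₃ z) →
    ¬ RepresentsBelow ((a₃ , m₃) ∷ (a₂ , m₂) ∷ (a₁ , m₁) ∷ []) (p ^ 2)
  ¬representsBelow-p² squareful p∤M a₃ m₃ a′ k a₃≡a′p avoids represented =
    contradiction-from (represented n n<p²)
    where
    t = k * + p - C
    w = proj₁ (inverse-mod prime M p∤M)
    p²∣w′M-1 : + (p ^ 2) ∣ₛ w * (+ 2 - w * M) * M - + 1
    p²∣w′M-1 = subst (λ d → d ∣ₛ w * (+ 2 - w * M) * M - + 1) (sym (pos-^2 p))
                     (inverse-lift w M (proj₂ (inverse-mod prime M p∤M)))
    solution = linear-congruence (w * (+ 2 - w * M)) M p²∣w′M-1 t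
    n = proj₁ solution
    n<p² = proj₁ (proj₂ solution)
    p²∣R : + p * + p ∣ₛ M * + n - t
    p²∣R = subst (λ d → d ∣ₛ M * + n - t) (pos-^2 p) (proj₂ (proj₂ solution))
    cancel : ∀ R S → R + S - R ≡ S
    cancel = solve-∀
    contradiction-from : Represents ((a₃ , m₃) ∷ (a₂ , m₂) ∷ (a₁ , m₁) ∷ []) n → ⊥
    contradiction-from ((z ∷ y ∷ x ∷ []) , F[zyx]≡n) = avoids z (*-cancelˡ-∣ (+ p) p²∣pG)
      where
      G = k - M * a′ * P m₃ z
      R = M * + n - t
      Q≡R+pG : A * X₁ x * X₁ x + B * X₂ y * X₂ y ≡ R + + p * G
      Q≡R+pG = quadratic-value a₃ m₃ a′ k x y z a₃≡a′p F[zyx]≡n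
      p∣Q : + p ∣ₛ A * X₁ x * X₁ x + B * X₂ y * X₂ y
      p∣Q = subst (+ p ∣ₛ_) (sym Q≡R+pG)
        (∣m∣n⇒∣m+n {m = R} {n = + p * G} (∣-trans (divides (+ p) refl) p²∣R) (∣m⇒∣m*n G ∣-refl))
      p²∣pG : + p * + p ∣ₛ + p * G
      p²∣pG = subst (+ p * + p ∣ₛ_) (trans (cong (_- R) Q≡R+pG) (cancel R (+ p * G)))
        (∣m∣n⇒∣m-n {m = A * X₁ x * X₁ x + B * X₂ y * X₂ y} {n = R} (squareful (X₁ x) (X₂ y) p∣Q) p²∣R)

  MissesResidue : ℕ → ℤ → Set
  MissesResidue m₃ a′ = ∃[ k ] ∀ z → ¬ + p ∣ₛ k - M * a′ * P m₃ z

  p∣a′⇒missesResidue : ∀ m₃ {a′} → + p ∣ₛ a′ → MissesResidue m₃ a′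
  p∣a′⇒missesResidue m₃ {a′} p∣a′ = + 1 , λ z p∣1-MaP →
    ∤1 prime (∣m+n∣n⇒∣m {m = + 1} {n = - (M * a′ * P m₃ z)} p∣1-MaP
                        (∣m⇒∣-m (∣m⇒∣m*n (P m₃ z) (∣n⇒∣m*n M p∣a′))))

  p∤D₃⇒missesResidue : (∀ W → ¬ + p ∣ₛ W * W + Δ) → ¬ + p ∣ₛ D₁ * D₂ →
    ∀ m₃ {a′} → ¬ + p ∣ₛ a′ → ¬ + p ∣ₛ + m₃ - + 2 → MissesResidue m₃ a′
  p∤D₃⇒missesResidue nonResidue p∤D₁D₂ m₃ {a′} p∤a′ p∤D₃ = u * L * V , λ z p∣k-MaP →
    ∤-* prime {x = L} {y = Z z * Z z + Δ} (∤-* prime p∤D₁D₂ p∤a′) (nonResidue (Z z))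
      (subst (+ p ∣ₛ_) (sym (L[Z²+Δ] z))
        (∣m∣n⇒∣m-n {m = (u * D₃ - + 1) * (L * V)} {n = D₃ * (u * L * V - M * a′ * P m₃ z)}
                   (∣m⇒∣m*n (L * V) p∣uD₃-1) (∣n⇒∣m*n D₃ p∣k-MaP)))
    where
    -- k ≡ (m₃−2)⁻¹·L·V, so that (m₃−2)·(k − M·a′·P_{m₃}(z)) ≡ −L·(Z² + Δ) (mod p).
    D₃ = + m₃ - + 2
    e₃ = + m₃ - + 4
    u = proj₁ (inverse-mod prime D₃ p∤D₃)
    p∣uD₃-1 = proj₂ (inverse-mod prime D₃ p∤D₃)
    L = D₁ * D₂ * a′
    V = - (Δ + e₃ * e₃)
    Z : ℤ → ℤ
    Z z = + 2 * D₃ * z - e₃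
    split : ∀ L Z² e² Δ → L * (Z² + Δ) ≡ L * ((Z² - e²) + e² + Δ)
    split = solve-∀
    collect : ∀ u D₁ D₂ D₃ a′ Δ e₃ P₃ → D₁ * D₂ * a′ * (+ 8 * D₃ * P₃ + e₃ * e₃ + Δ)
            ≡ (u * D₃ - + 1) * (D₁ * D₂ * a′ * - (Δ + e₃ * e₃))
              - D₃ * (u * (D₁ * D₂ * a′) * - (Δ + e₃ * e₃) - + 8 * D₁ * D₂ * a′ * P₃)
    collect = solve-∀
    L[Z²+Δ] : ∀ z → L * (Z z * Z z + Δ) ≡ (u * D₃ - + 1) * (L * V) - D₃ * (u * L * V - M * a′ * P m₃ z)
    L[Z²+Δ] z = begin
      L * (Z z * Z z + Δ)                          ≡⟨ split L (Z z * Z z) (e₃ * e₃) Δ ⟩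
      L * ((Z z * Z z - e₃ * e₃) + e₃ * e₃ + Δ)    ≡⟨ cong (λ s → L * (s + e₃ * e₃ + Δ)) (sym (P-complete-square m₃ z)) ⟩
      L * (+ 8 * D₃ * P m₃ z + e₃ * e₃ + Δ)        ≡⟨ collect u D₁ D₂ D₃ a′ Δ e₃ (P m₃ z) ⟩
      (u * D₃ - + 1) * (L * V) - D₃ * (u * L * V - M * a′ * P m₃ z) ∎
      where open ≡-Reasoning

  missesResidue : (∀ W → ¬ + p ∣ₛ W * W + Δ) → ¬ + p ∣ₛ D₁ * D₂ →
    ∀ m₃ {a′} → + p ∣ₛ a′ ⊎ ¬ + p ∣ₛ + m₃ - + 2 → MissesResidue m₃ a′
  missesResidue nonResidue p∤D₁D₂ m₃ {a′} p∣a′⊎p∤D₃ = choose (+ p ∣ₛ? a′) p∣a′⊎p∤D₃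
    where
    choose : Dec (+ p ∣ₛ a′) → + p ∣ₛ a′ ⊎ ¬ + p ∣ₛ + m₃ - + 2 → MissesResidue m₃ a′
    choose (yes p∣a′) _           = p∣a′⇒missesResidue m₃ p∣a′
    choose (no p∤a′) (inj₁ p∣a′) = contradiction p∣a′ p∤a′
    choose (no p∤a′) (inj₂ p∤D₃) = p∤D₃⇒missesResidue nonResidue p∤D₁D₂ m₃ p∤a′ p∤D₃

  obstruction : 3 ℕ.≤ p → ¬ + p ∣ₛ Δ → (∀ W → ¬ + p ∣ₛ W * W + Δ) →
    ∀ a₃ m₃ → ¬ (∃[ a′ ] + a₃ ≡ a′ * + p × (+ p ∣ₛ a′ ⊎ ¬ + p ∣ₛ + m₃ - + 2)
                         × RepresentsBelow ((a₃ , m₃) ∷ (a₂ , m₂) ∷ (a₁ , m₁) ∷ []) (p ^ 2))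
  obstruction p≥3 p∤Δ nonResidue a₃ m₃ (a′ , a₃≡a′p , p∣a′⊎p∤D₃ , represented) =
    ¬representsBelow-p² squareful p∤M a₃ m₃ a′ (proj₁ k-missed) a₃≡a′p (proj₂ k-missed) represented
    where
    p∤a₁ : ¬ + p ∣ₛ + a₁
    p∤a₁ = p∤Δ ∘ ∣m⇒∣m*n D₂ ∘ ∣m⇒∣m*n D₁ ∘ ∣m⇒∣m*n (+ a₂)
    p∤D₁ : ¬ + p ∣ₛ D₁
    p∤D₁ = p∤Δ ∘ ∣m⇒∣m*n D₂ ∘ ∣n⇒∣m*n (+ a₁ * + a₂)
    p∤D₂ : ¬ + p ∣ₛ D₂
    p∤D₂ = p∤Δ ∘ ∣n⇒∣m*n (+ a₁ * + a₂ * D₁)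
    p∤2 : ¬ + p ∣ₛ + 2
    p∤2 p∣2 = ℕ.<⇒≱ p≥3 (ℕ.∣⇒≤ (∣⇒∣ᵤ p∣2))
    p∤M : ¬ + p ∣ₛ M
    p∤M = ∤-* prime (∤-* prime (∤-* prime p∤2 (∤-* prime p∤2 p∤2)) p∤D₁) p∤D₂
    nonResidue′ : ∀ W → ¬ + p ∣ₛ W * W + A * B
    nonResidue′ W = nonResidue W ∘ subst (λ c → + p ∣ₛ W * W + c) (AB≡Δ (+ a₁) (+ a₂) D₁ D₂)
      where
      AB≡Δ : ∀ a₁ a₂ D₁ D₂ → a₁ * D₂ * (a₂ * D₁) ≡ a₁ * a₂ * D₁ * D₂
      AB≡Δ = solve-∀
    squareful : ∀ X Y → + p ∣ₛ A * X * X + B * Y * Y → + p * + p ∣ₛ A * X * X + B * Y * Y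
    squareful X Y p∣Q with anisotropic prime (∤-* prime p∤a₁ p∤D₂) nonResidue′ X Y p∣Q
    ... | p∣X , p∣Y = square-∣ A B X Y p∣X p∣Y
    k-missed : MissesResidue m₃ a′
    k-missed = missesResidue nonResidue (∤-* prime p∤D₁ p∤D₂) m₃ p∣a′⊎p∤D₃

lemma2p9 : (p : ℕ) → .{{_ : ℕ.NonZero p}} → Prime p → 3 ≤ p →
    (a₁ m₁ a₂ m₂ a₃ m₃ : ℕ) →
    Node ((a₃ , m₃) ∷ (a₂ , m₂) ∷ (a₁ , m₁) ∷ []) →
    ¬ ((+ p) ∣ (+ a₁ ℤ.* + a₂ ℤ.* (+ m₁ ℤ.- + 2) ℤ.* (+ m₂ ℤ.- + 2))) →
    ((+ (p ^ 2)) ∣ (+ a₃)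
      ⊎ ((+ p) ∣ (+ a₃) × ¬ ((+ p) ∣ (+ m₃ ℤ.- + 2))
          × TruantAtLeast ((a₃ , m₃) ∷ (a₂ , m₂) ∷ (a₁ , m₁) ∷ []) (p ^ 2))) →
    legendre (- (+ a₁ ℤ.* + a₂ ℤ.* (+ m₁ ℤ.- + 2) ℤ.* (+ m₂ ℤ.- + 2))) p ≡ + 1
lemma2p9 p p-prime p≥3 a₁ m₁ a₂ m₂ a₃ m₃ node p∤Δ hypotheses = by-cases (legendre-cases (- Δ) p)
  where
  open Obstruction p-prime a₁ m₁ a₂ m₂
  by-cases : legendre (- Δ) p ≡ + 1 ⊎ + p ∣ₛ - Δ ⊎ (∀ W → ¬ + p ∣ₛ W * W - - Δ) → legendre (- Δ) p ≡ + 1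
  by-cases (inj₁ residue)            = residue
  by-cases (inj₂ (inj₁ p∣-Δ))        =
    contradiction (∣⇒∣ᵤ (subst (+ p ∣ₛ_) (ℤ.neg-involutive Δ) (∣m⇒∣-m p∣-Δ))) p∤Δ
  by-cases (inj₂ (inj₂ nonResidue)) =
    ⊥-elim (obstruction p≥3 (p∤Δ ∘ ∣⇒∣ᵤ) nonResidue′ a₃ m₃ (p∣a₃∧representsBelow-p² p node hypotheses))
    where
    nonResidue′ : ∀ W → ¬ + p ∣ₛ W * W + Δ
    nonResidue′ W = nonResidue W ∘ subst (λ c → + p ∣ₛ W * W + c) (sym (ℤ.neg-involutive Δ))
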